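{- Let $\ell\ge3$, let $\lambda$ be an $\ell$-regular partition and $i$ a residue. Then the $i$-signature of $\lambda$ (and hence its reduced $i$-signature) equals the word obtained by writing $+$ for each addable $i$-box and $-$ for each removable $i$-box of $\lambda$, reading the ladders from leftmost to rightmost and, within each ladder, from bottom to top.
   Context: An $\ell$-regular partition has no nonzero part repeated $\ell$ or more times. Young diagrams in English notation; $(a,b)$ is the box in row $a$, column $b$, residue $b-a\bmod\ell$. Removable (resp. addable) $i$-box: a box in $\lambda$ (resp. position not in $\lambda$) of residue $i$ whose removal (resp. addition) yields a partition. The $i$-signature of $\lambda$ is the word with $+$ for each addable $i$-box and $-$ for each removable $i$-box, read from bottom left to top right, i.e. in order of decreasing row index; the reduced $i$-signature is obtained by repeatedly deleting adjacent pairs "$-+$". The ladder of $(a,b)$ is the set of positions $(c,d)$, $c,d\ge1$, with $c+(\ell-1)d=a+(\ell-1)b$; ladders are ordered from left to right by increasing $c+(\ell-1)d$; within a ladder, "bottom to top" means decreasing row index. -}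

module Defs where

open import Data.Nat using (ℕ; zero; suc; _+_; _*_; _∸_; _≤_; _<_; _>_)
open import Data.Nat.Properties using (_≟_)
open import Data.Integer as ℤ using (ℤ; +_)
open import Data.Integer.Divisibility as ℤd using ()
open import Data.Fin using (Fin; toℕ)
open import Data.List using (List; []; _∷_; length; filter; map)
open import Data.List.Relation.Unary.All using (All)
open import Data.List.Relation.Unary.Linked using (Linked)
open import Data.List.Membership.Propositional using (_∈_)
open import Data.Product using (_×_; _,_; Σ; ∃; proj₁; proj₂)
open import Data.Sum using (_⊎_)
open import Relation.Nullary using (¬_)
open import Relation.Binary.PropositionalEquality using (_≡_)
open import Function.Bundles using (_⇔_)

Partition : Set
Partition = List ℕ

IsPartition : List ℕ → Set
IsPartition μ = All (λ p → 0 < p) μ × Linked (λ x y → y ≤ x) μ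

-- length of row a (rows indexed from 1; 0 outside)
row : List ℕ → ℕ → ℕ
row []       _             = 0
row (p ∷ ps) zero          = 0
row (p ∷ ps) (suc zero)    = p
row (p ∷ ps) (suc (suc a)) = row ps (suc a)

mult : ℕ → List ℕ → ℕ
mult v μ = length (filter (v ≟_) μ)

Regular : ℕ → Partition → Set
Regular ℓ μ = ∀ v → 0 < v → mult v μ < ℓ

-- positions (a , b) = row a, column b
Pos : Set
Pos = ℕ × ℕ

InDiagram : Partition → Pos → Set
InDiagram μ (a , b) = 1 ≤ a × 1 ≤ b × b ≤ row μ a

HasResidue : (ℓ : ℕ) → Fin ℓ → Pos → Set
HasResidue ℓ i (a , b) = (+ ℓ) ℤd.∣ ((+ b ℤ.- + a) ℤ.- + toℕ i)

Addable : Partition → Pos → Set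
Addable μ p = ¬ InDiagram μ p ×
  Σ Partition (λ ν → IsPartition ν × (∀ q → InDiagram ν q ⇔ (InDiagram μ q ⊎ q ≡ p)))

Removable : Partition → Pos → Set
Removable μ p = InDiagram μ p ×
  Σ Partition (λ ν → IsPartition ν × (∀ q → InDiagram ν q ⇔ (InDiagram μ q × ¬ q ≡ p)))

data Sign : Set where
  plus minus : Sign

-- a signed box: + for addable, - for removable
SBox : Set
SBox = Sign × Pos

Enumerates : (ℓ : ℕ) → Fin ℓ → Partition → List SBox → Set
Enumerates ℓ i μ L = ∀ s p → ((s , p) ∈ L) ⇔
  ((s ≡ plus × Addable μ p × HasResidue ℓ i p) ⊎ (s ≡ minus × Removable μ p × HasResidue ℓ i p))

rowOf : SBox → ℕ
rowOf (_ , (a , _)) = a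

ladderOf : ℕ → SBox → ℕ
ladderOf ℓ (_ , (a , b)) = a + (ℓ ∸ 1) * b

RowOrder : SBox → SBox → Set
RowOrder x y = rowOf x > rowOf y

LadderOrder : ℕ → SBox → SBox → Set
LadderOrder ℓ x y = ladderOf ℓ x < ladderOf ℓ y ⊎ (ladderOf ℓ x ≡ ladderOf ℓ y × rowOf x > rowOf y)

word : List SBox → List Sign
word = map proj₁

IsSignature : (ℓ : ℕ) → Fin ℓ → Partition → List Sign → Set
IsSignature ℓ i μ w = Σ (List SBox) λ L → Enumerates ℓ i μ L × Linked RowOrder L × w ≡ word L

IsLadderWord : (ℓ : ℕ) → Fin ℓ → Partition → List Sign → Set
IsLadderWord ℓ i μ w = Σ (List SBox) λ L → Enumerates ℓ i μ L × Linked (LadderOrder ℓ) L × w ≡ word L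

module Submission where

-- Let q = ℓ - 1 and let x = (a , b), y = (c , d) be addable or removable
-- i-boxes of λ with x strictly below y (c < a).  Every such box is a
-- boundary box: b ≤ λ_a + 1, λ_{a+1} < b and, if a ≥ 2, b ≤ λ_{a-1}.
-- Regularity forces the parts to drop strictly across every q consecutive
-- rows, so λ_{c+1+qn} + n ≤ λ_{c+1} whenever λ_{c+1+qn} > 0.  Writing
-- d = b + n, the boundary conditions then give a - 1 ≤ c + qn, and since x
-- and y share the residue i, ℓ divides (a - c) + n, which excludes
-- a - 1 = c + qn.  Hence a + qb ≤ c + qd: the ladder of x is weakly left of
-- the ladder of y.  So the listing of the i-boxes by decreasing row (which
-- defines the i-signature) is already in ladder reading order.

open import Defs
open import Data.Nat using (ℕ; zero; suc; pred; _+_; _*_; _≤_; _<_; z≤n; s≤s)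
open import Data.Nat.Properties
import Data.Nat.Divisibility as ℕ
import Data.Integer as ℤ
import Data.Integer.Properties as ℤₚ
import Data.Integer.Divisibility.Signed as ℤ∣
open import Data.Integer.Solver using () renaming (module +-*-Solver to ℤ-Solver)
open import Data.Nat.Solver using () renaming (module +-*-Solver to ℕ-Solver)
open import Data.Fin using (Fin; toℕ)
open import Data.List using (List; []; _∷_; length)
import Data.List.Properties as List
open import Data.List.Relation.Unary.All as All using (All; _∷_)
open import Data.List.Relation.Unary.Linked as Linked using (Linked; []; [-]; _∷_)
open import Data.List.Membership.Propositional using (_∈_)
open import Data.Product using (_×_; _,_; proj₁; proj₂)
open import Data.Sum using (inj₁; inj₂)
open import Function using (_∘_)
open import Function.Bundles using (Equivalence)
open import Relation.Nullary using (¬_; yes; no; contradiction)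
open import Relation.Binary.PropositionalEquality

Decreasing : List ℕ → Set
Decreasing = Linked (λ x y → y ≤ x)

row-antitone : ∀ {μ} → Decreasing μ → ∀ {s t} → 1 ≤ s → s ≤ t → row μ t ≤ row μ s
row-antitone {[]}         _           _   _         = z≤n
row-antitone {p ∷ ps}     _           {1} {1} _ _   = ≤-refl
row-antitone {p ∷ []}     _           {1} {suc (suc t)} _ _ = z≤n
row-antitone {p ∷ q ∷ ps} (q≤p ∷ dec) {1} {suc (suc t)} _ _ =
  ≤-trans (row-antitone dec {1} {suc t} (s≤s z≤n) (s≤s z≤n)) q≤p
row-antitone {p ∷ ps}     dec {suc (suc s)} {suc (suc t)} _ (s≤s s≤t) =
  row-antitone (Linked.tail dec) (s≤s z≤n) s≤t

mult-cons-same : ∀ v ps → mult v (v ∷ ps) ≡ suc (mult v ps)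
mult-cons-same v ps = cong length (List.filter-accept (v ≟_) {v} {ps} refl)

mult-cons : ∀ v p ps → mult v ps ≤ mult v (p ∷ ps)
mult-cons v p ps with v ≟ p
... | yes v≡p = ≤-trans (n≤1+n _)
                  (≤-reflexive (sym (cong length (List.filter-accept (v ≟_) {p} {ps} v≡p))))
... | no  v≢p = ≤-reflexive (sym (cong length (List.filter-reject (v ≟_) {p} {ps} v≢p)))

run-mult : ∀ μ s v j → 0 < v → (∀ t → t ≤ j → row μ (suc s + t) ≡ v) → suc j ≤ mult v μ
run-mult []       s        v j 0<v run = contradiction (run 0 z≤n) (<⇒≢ 0<v)
run-mult (p ∷ ps) (suc s)  v j 0<v run = ≤-trans (run-mult ps s v j 0<v run) (mult-cons v p ps)
run-mult (p ∷ ps) zero     v j 0<v run with run 0 z≤n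
... | refl rewrite mult-cons-same p ps with j
...   | zero   = s≤s z≤n
...   | suc j′ = s≤s (run-mult ps 0 p j′ 0<v (λ t t≤j′ → run (suc t) (s≤s t≤j′)))

module Regularity (q : ℕ) {μ : Partition} (dec : Decreasing μ) (reg : Regular (suc q) μ) where

  -- Across q consecutive row steps a positive part strictly decreases:
  -- otherwise the q + 1 rows s + 1, …, s + 1 + q would have equal length.
  regular-drop : ∀ s → 0 < row μ (suc s + q) → row μ (suc s + q) < row μ (suc s)
  regular-drop s 0<v with row μ (suc s + q) <? row μ (suc s)
  ... | yes drop = drop
  ... | no ¬drop = contradiction (reg v 0<v) (≤⇒≯ (run-mult μ s v q 0<v constant))
    where
      v : ℕ
      v = row μ (suc s + q)
      constant : ∀ t → t ≤ q → row μ (suc s + t) ≡ v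
      constant t t≤q = ≤-antisym
        (≤-trans (row-antitone dec (s≤s z≤n) (m≤m+n (suc s) t)) (≮⇒≥ ¬drop))
        (row-antitone dec (s≤s z≤n) (+-monoʳ-≤ (suc s) t≤q))

  regular-descent : ∀ k s → 0 < row μ (suc s + q * k) → row μ (suc s + q * k) + k ≤ row μ (suc s)
  regular-descent zero s 0<v rewrite *-zeroʳ q | +-identityʳ s | +-identityʳ (row μ (suc s)) = ≤-refl
  regular-descent (suc k) s 0<v = begin
    row μ (suc s + q * suc k) + suc k      ≡⟨ cong (λ r → row μ r + suc k) shift ⟩
    row μ (suc (s + q) + q * k) + suc k    ≡⟨ +-suc _ k ⟩
    suc (row μ (suc (s + q) + q * k) + k)  ≤⟨ s≤s (regular-descent k (s + q) 0<v′) ⟩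
    suc (row μ (suc s + q))                ≤⟨ regular-drop s (<-≤-trans 0<v′ (row-antitone dec (s≤s z≤n) (m≤m+n _ (q * k)))) ⟩
    row μ (suc s)                          ∎
    where
      open ≤-Reasoning
      shift : suc s + q * suc k ≡ suc (s + q) + q * k
      shift = cong suc (trans (cong (s +_) (*-suc q k)) (sym (+-assoc s q (q * k))))
      0<v′ : 0 < row μ (suc (s + q) + q * k)
      0<v′ = subst (λ r → 0 < row μ r) shift 0<v

  descent-bound : ∀ {c a′ b n} → 0 < b → b ≤ row μ a′ → row μ (suc c) < b + n → a′ ≤ c + q * n
  descent-bound {c} {a′} {b} {n} 0<b b≤row short with a′ ≤? c + q * n
  ... | yes near = near
  ... | no  far  = contradiction short (≤⇒≯ long)
    where
      open ≤-Reasoning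
      b≤row′ : b ≤ row μ (suc c + q * n)
      b≤row′ = ≤-trans b≤row (row-antitone dec (s≤s z≤n) (≰⇒> far))
      long : b + n ≤ row μ (suc c)
      long = begin
        b + n                        ≤⟨ +-monoˡ-≤ n b≤row′ ⟩
        row μ (suc c + q * n) + n    ≤⟨ regular-descent n c (<-≤-trans 0<b b≤row′) ⟩
        row μ (suc c)                ∎

diagram-left : ∀ {μ a b b′} → 1 ≤ b′ → b′ ≤ b → InDiagram μ (a , b) → InDiagram μ (a , b′)
diagram-left 1≤b′ b′≤b (1≤a , _ , b≤r) = 1≤a , 1≤b′ , ≤-trans b′≤b b≤r

diagram-up : ∀ {μ a a′ b} → Decreasing μ → 1 ≤ a′ → a′ ≤ a → InDiagram μ (a , b) → InDiagram μ (a′ , b)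
diagram-up dec 1≤a′ a′≤a (_ , 1≤b , b≤r) = 1≤a′ , 1≤b , ≤-trans b≤r (row-antitone dec 1≤a′ a′≤a)

record Boundary (μ : Partition) (a b : ℕ) : Set where
  field
    row-pos    : 1 ≤ a
    col-near   : b ≤ suc (row μ a)
    below-ends : row μ (suc a) < b
    above-full : 1 < a → b ≤ row μ (pred a)

one-beyond : ∀ b r → (1 < b → pred b ≤ r) → b ≤ suc r
one-beyond zero          r _ = z≤n
one-beyond (suc zero)    r _ = s≤s z≤n
one-beyond (suc (suc b)) r h = s≤s (h (s≤s (s≤s z≤n)))

pred-≢ : ∀ {a} → 1 ≤ a → pred a ≢ a
pred-≢ {suc a} _ = <⇒≢ (n<1+n a)

addable⇒boundary : ∀ {μ a b} → Decreasing μ → Addable μ (a , b) → Boundary μ a b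
addable⇒boundary {μ} {a} {b} dec (∉μ , ν , (_ , decν) , ν≅μ+p) = record
  { row-pos    = 1≤a
  ; col-near   = one-beyond b (row μ a) left-in-μ
  ; below-ends = ≤-<-trans (row-antitone dec 1≤a (n≤1+n a)) row<b
  ; above-full = above-in-μ
  }
  where
    ∈ν : InDiagram ν (a , b)
    ∈ν = Equivalence.from (ν≅μ+p (a , b)) (inj₂ refl)
    1≤a : 1 ≤ a
    1≤a = proj₁ ∈ν
    1≤b : 1 ≤ b
    1≤b = proj₁ (proj₂ ∈ν)
    row<b : row μ a < b
    row<b = ≰⇒> (λ b≤row → ∉μ (1≤a , 1≤b , b≤row))
    old : ∀ {r} → InDiagram ν r → ¬ r ≡ (a , b) → InDiagram μ r
    old {r} r∈ν r≢p with Equivalence.to (ν≅μ+p r) r∈ν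
    ... | inj₁ r∈μ = r∈μ
    ... | inj₂ r≡p = contradiction r≡p r≢p
    left-in-μ : 1 < b → pred b ≤ row μ a
    left-in-μ 1<b = proj₂ (proj₂ (old (diagram-left {ν} (<⇒≤pred 1<b) pred[n]≤n ∈ν)
                                      (pred-≢ 1≤b ∘ cong proj₂)))
    above-in-μ : 1 < a → b ≤ row μ (pred a)
    above-in-μ 1<a = proj₂ (proj₂ (old (diagram-up decν (<⇒≤pred 1<a) pred[n]≤n ∈ν)
                                       (pred-≢ 1≤a ∘ cong proj₁)))

removable⇒boundary : ∀ {μ a b} → Decreasing μ → Removable μ (a , b) → Boundary μ a b
removable⇒boundary {μ} {a} {b} dec ((1≤a , 1≤b , b≤row) , ν , (_ , decν) , ν≅μ-p) = record
  { row-pos    = 1≤a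
  ; col-near   = m≤n⇒m≤1+n b≤row
  ; below-ends = ≰⇒> below-in-μ⇒⊥
  ; above-full = λ 1<a → ≤-trans b≤row (row-antitone dec (<⇒≤pred 1<a) pred[n]≤n)
  }
  where
    -- if (a + 1 , b) were in μ it would survive in ν, and then so would (a , b)
    below-in-μ⇒⊥ : ¬ b ≤ row μ (suc a)
    below-in-μ⇒⊥ b≤row′ = proj₂ (Equivalence.to (ν≅μ-p (a , b)) p∈ν) refl
      where
        below∈ν : InDiagram ν (suc a , b)
        below∈ν = Equivalence.from (ν≅μ-p (suc a , b)) ((s≤s z≤n , 1≤b , b≤row′) , λ ())
        p∈ν : InDiagram ν (a , b)
        p∈ν = diagram-up decν 1≤a (n≤1+n a) below∈ν

-- Going from (c , b + n) to (c + m , b), i.e. m rows down and n columns left,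
-- lowers the content (column - row) by m + n; so if both boxes have the same
-- residue modulo ℓ, then ℓ ∣ m + n.
residue-gap : ∀ ℓ (i : Fin ℓ) c m b n →
  HasResidue ℓ i (c + m , b) → HasResidue ℓ i (c , b + n) → ℓ ℕ.∣ m + n
residue-gap ℓ i c m b n lower upper =
  ℤ∣.∣⇒∣ᵤ (subst (ℤ∣._∣_ (+ ℓ)) difference
    (ℤ∣.∣m∣n⇒∣m-n (ℤ∣.∣ᵤ⇒∣ {+ ℓ} {upper-content} upper) (ℤ∣.∣ᵤ⇒∣ {+ ℓ} {lower-content} lower)))
  where
    open ℤ using (+_; _-_)
    open ℤ-Solver
    upper-content : ℤ.ℤ
    upper-content = (+ (b + n) - + c) - + toℕ i
    lower-content : ℤ.ℤ
    lower-content = (+ b - + (c + m)) - + toℕ i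
    difference : upper-content - lower-content ≡ + (m + n)
    difference rewrite ℤₚ.pos-+ b n | ℤₚ.pos-+ c m | ℤₚ.pos-+ m n =
      solve 5 (λ b n c m i → ((b :+ n :- c) :- i) :- ((b :- (c :+ m)) :- i) := m :+ n) refl
        (+ b) (+ n) (+ c) (+ m) (+ toℕ i)

module Ladders (q : ℕ) (1≤q : 1 ≤ q) {μ : Partition} (dec : Decreasing μ)
               (reg : Regular (suc q) μ) (i : Fin (suc q)) where
  open Regularity q dec reg using (descent-bound)

  not-one-more : ∀ n → ¬ suc q ℕ.∣ suc (q * n) + n
  not-one-more n ℓ∣ = contradiction (ℕ.∣1⇒≡1 ℓ∣1) (<⇒≢ (s≤s 1≤q) ∘ sym)
    where
      open ℕ-Solver
      rearranged : suc (q * n) + n ≡ suc q * n + 1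
      rearranged = solve 2 (λ q n → (con 1 :+ q :* n) :+ n := (con 1 :+ q) :* n :+ con 1) refl q n
      ℓ∣1 : suc q ℕ.∣ 1
      ℓ∣1 = ℕ.∣m+n∣m⇒∣n (subst (suc q ℕ.∣_) rearranged ℓ∣) (ℕ.m∣m*n n)

  columns-ordered : ∀ {a b c d} → Boundary μ a b → Boundary μ c d → c < a → b ≤ d
  columns-ordered {a} {b} {c} {d} x y c<a = begin
    b                  ≤⟨ Boundary.col-near x ⟩
    suc (row μ a)      ≤⟨ s≤s (row-antitone dec (s≤s z≤n) c<a) ⟩
    suc (row μ (suc c)) ≤⟨ Boundary.below-ends y ⟩
    d                  ∎
    where open ≤-Reasoning

  ladder-monotone : ∀ {a b c d} → Boundary μ a b → HasResidue (suc q) i (a , b) →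
    Boundary μ c d → HasResidue (suc q) i (c , d) → c < a → a + q * b ≤ c + q * d
  ladder-monotone {suc a′} {b} {c} x x-res y y-res c<a
    with m≤n⇒∃[o]m+o≡n (columns-ordered x y c<a)
  ... | n , refl = begin
    suc a′ + q * b     ≤⟨ +-monoˡ-≤ (q * b) (≤∧≢⇒< a′≤ a′≢) ⟩
    c + q * n + q * b  ≡⟨ +-assoc c (q * n) (q * b) ⟩
    c + (q * n + q * b) ≡⟨ cong (c +_) (trans (+-comm (q * n) (q * b)) (sym (*-distribˡ-+ q b n))) ⟩
    c + q * (b + n)    ∎
    where
      open ≤-Reasoning
      1<a : 1 < suc a′
      1<a = ≤-trans (s≤s (Boundary.row-pos y)) c<a
      a′≤ : a′ ≤ c + q * n
      a′≤ = descent-bound (≤-<-trans z≤n (Boundary.below-ends x))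
                          (Boundary.above-full x 1<a) (Boundary.below-ends y)
      -- equality would put x exactly 1 + q n rows and n columns from y,
      -- contradicting equal residues
      a′≢ : a′ ≢ c + q * n
      a′≢ refl = not-one-more n (residue-gap (suc q) i c (suc (q * n)) b n
        (subst (λ r → HasResidue (suc q) i (r , b)) (sym (+-suc c (q * n))) x-res) y-res)

  BoundaryIBox : SBox → Set
  BoundaryIBox (_ , (a , b)) = Boundary μ a b × HasResidue (suc q) i (a , b)

  listed⇒boundary : ∀ {L} → Enumerates (suc q) i μ L → ∀ {x} → x ∈ L → BoundaryIBox x
  listed⇒boundary enum {s , p} x∈L with Equivalence.to (enum s p) x∈L
  ... | inj₁ (_ , addable   , res) = addable⇒boundary dec addable , res
  ... | inj₂ (_ , removable , res) = removable⇒boundary dec removable , res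

  row⇒ladder : ∀ {x y} → BoundaryIBox x → BoundaryIBox y → RowOrder x y → LadderOrder (suc q) x y
  row⇒ladder (x , x-res) (y , y-res) below with m≤n⇒m<n∨m≡n (ladder-monotone x x-res y y-res below)
  ... | inj₁ earlier    = inj₁ earlier
  ... | inj₂ same-ladder = inj₂ (same-ladder , below)

Linked-strengthen : ∀ {A : Set} {P : A → Set} {R S : A → A → Set} →
  (∀ {x y} → P x → P y → R x y → S x y) → ∀ {xs} → All P xs → Linked R xs → Linked S xs
Linked-strengthen R⇒S _                []         = []
Linked-strengthen R⇒S _                [-]        = [-]
Linked-strengthen R⇒S (px ∷ py ∷ pxs) (r ∷ rs) = R⇒S px py r ∷ Linked-strengthen R⇒S (py ∷ pxs) rs

-- Theorem 9.3: any listing of the addable/removable i-boxes by decreasing row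
-- (an i-signature) is already in ladder reading order, so the two words agree.
-- (The argument only needs ℓ ≥ 2.)
theorem9p3 : (ℓ : ℕ) → 3 ≤ ℓ → (μ : Partition) → IsPartition μ → Regular ℓ μ → (i : Fin ℓ) →
    (w : List Sign) → IsSignature ℓ i μ w → IsLadderWord ℓ i μ w
theorem9p3 (suc (suc k)) (s≤s (s≤s _)) μ (_ , dec) reg i w (L , enum , row-sorted , w≡L) =
  L , enum , ladder-sorted , w≡L
  where
    open Ladders (suc k) (s≤s z≤n) dec reg i
    ladder-sorted : Linked (LadderOrder (suc (suc k))) L
    ladder-sorted = Linked-strengthen (λ {x} {y} → row⇒ladder {x} {y})
                      (All.tabulate (listed⇒boundary enum)) row-sorted
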